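{- For every integer $m\geq 1$, the graph $m\Gamma(\mathbb{Z}_6)+\overline{\Gamma(\mathbb{Z}_9)}$ (the join of $m\Gamma(\mathbb{Z}_6)$ and $\overline{\Gamma(\mathbb{Z}_9)}$) does not admit a distance antimagic labeling.
   Context: For an integer $n \geq 2$, the zero-divisor graph $\Gamma(\mathbb{Z}_n)$ is the simple graph whose vertex set is the set of nonzero zero-divisors of the ring $\mathbb{Z}_n$, two distinct vertices $u,v$ being adjacent iff $uv \equiv 0 \pmod n$. $\overline{H}$ denotes the complement of a graph $H$. For a graph $H$ and positive integer $k$, $kH$ denotes the disjoint union of $k$ copies of $H$. For graphs $G,H$, the join $G+H$ is the graph obtained from the disjoint union of $G$ and $H$ by adding every edge between a vertex of $G$ and a vertex of $H$. A distance antimagic labeling (DAML) of a graph $G$ with $N$ vertices is a bijection $f:V(G)\to\{1,\dots,N\}$ such that the weights $w(v)=\sum_{u\in N(v)} f(u)$, where $N(v)$ is the open neighbourhood of $v$, are pairwise distinct over all vertices $v$. A graph admits DAML if such a labeling exists. -}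

module Defs where

open import Data.Nat using (ℕ; zero; suc; _+_; _*_; _∸_; NonZero)
open import Data.Nat.DivMod using (_%_)
open import Data.Bool using (Bool; true; false; not; _∧_; _∨_; if_then_else_)
open import Data.Fin using (Fin; toℕ; splitAt)
open import Data.Fin.Properties using () renaming (_≟_ to _≟ᶠ_)
open import Data.List using (List; filter; length; lookup; map; upTo)
open import Data.Sum using (inj₁; inj₂)
open import Data.Bool.ListAction using (any)
open import Data.Product using (Σ; _×_; _,_)
open import Relation.Nullary.Decidable using (⌊_⌋; yes; no)
open import Function.Bundles using (_⤖_; Bijection)
open import Function.Definitions using (Injective)
open import Relation.Binary.PropositionalEquality using (_≡_)
open import Data.Vec.Functional using () renaming (foldr to vfoldr)

record Graph : Set where
  field
    size : ℕ
    adj  : Fin size → Fin size → Bool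
open Graph public

_==_ : ℕ → ℕ → Bool
m == n = ⌊ m Data.Nat.≟ n ⌋
  where import Data.Nat

_=ᶠ_ : ∀ {n} → Fin n → Fin n → Bool
i =ᶠ j = ⌊ i ≟ᶠ j ⌋

nonzeroResidues : ℕ → List ℕ
nonzeroResidues n = map suc (upTo (n ∸ 1))

isZeroDivisor : (n : ℕ) → .{{NonZero n}} → ℕ → Bool
isZeroDivisor n x = any (λ y → ((x * y) % n) == 0) (nonzeroResidues n)

zdVertices : (n : ℕ) → .{{NonZero n}} → List ℕ
zdVertices n = filter (λ x → isZeroDivisor n x Data.Bool.≟ true) (nonzeroResidues n)
  where import Data.Bool

ZDGraph : (n : ℕ) → .{{NonZero n}} → Graph
ZDGraph n = record
  { size = length (zdVertices n)
  ; adj  = λ i j → not (i =ᶠ j) ∧ (((lookup (zdVertices n) i * lookup (zdVertices n) j) % n) == 0)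
  }

complement : Graph → Graph
complement G = record
  { size = size G
  ; adj  = λ i j → not (i =ᶠ j) ∧ not (adj G i j)
  }

disjointUnion : Graph → Graph → Graph
disjointUnion G H = record
  { size = size G + size H
  ; adj  = λ i j → a (splitAt (size G) i) (splitAt (size G) j)
  }
  where
    a : _ → _ → Bool
    a (inj₁ x) (inj₁ y) = adj G x y
    a (inj₂ x) (inj₂ y) = adj H x y
    a _ _ = false

join : Graph → Graph → Graph
join G H = record
  { size = size G + size H
  ; adj  = λ i j → a (splitAt (size G) i) (splitAt (size G) j)
  }
  where
    a : _ → _ → Bool
    a (inj₁ x) (inj₁ y) = adj G x y
    a (inj₂ x) (inj₂ y) = adj H x y
    a _ _ = true

emptyGraph : Graph
emptyGraph = record { size = 0 ; adj = λ () }

copies : ℕ → Graph → Graph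
copies zero    H = emptyGraph
copies (suc k) H = disjointUnion H (copies k H)

∑ : ∀ {n} → (Fin n → ℕ) → ℕ
∑ g = vfoldr _+_ 0 g

-- weight of v under labeling f (label of u is 1 + toℕ (f u) ∈ {1,…,N}):
-- sum of labels over the open neighbourhood of v
weight : (G : Graph) → (Fin (size G) → Fin (size G)) → Fin (size G) → ℕ
weight G f v = ∑ (λ u → if adj G v u then suc (toℕ (f u)) else 0)

IsDAML : (G : Graph) → (Fin (size G) ⤖ Fin (size G)) → Set
IsDAML G f = Injective _≡_ _≡_ (weight G (Bijection.to f))

AdmitsDAML : Graph → Set
AdmitsDAML G = Σ (Fin (size G) ⤖ Fin (size G)) (IsDAML G)

-- Γ(ℤ₉) is the single edge {3, 6}, so its complement consists of two isolated
-- vertices. In a join G + H two vertices of H with the same neighbourhood in H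
-- are adjacent to exactly the same vertices, whatever G is; hence they receive
-- the same weight under every labeling, and no labeling is distance antimagic.
module Submission where

open import Defs
open import Data.Nat using (ℕ; _≥_; zero; suc; _+_)
open import Data.Fin using (Fin; zero; suc; _↑ʳ_; splitAt; toℕ)
open import Data.Fin.Properties using (splitAt-↑ʳ; ↑ʳ-injective)
open import Data.Sum using (inj₁; inj₂)
open import Data.Bool using (false; if_then_else_)
open import Data.Product using (_,_)
open import Function.Bundles using (Bijection)
open import Relation.Nullary using (¬_)
open import Relation.Binary.PropositionalEquality

∑-cong : ∀ {n} {f g : Fin n → ℕ} → (∀ i → f i ≡ g i) → ∑ f ≡ ∑ g
∑-cong {zero}  f≗g = refl
∑-cong {suc n} f≗g = cong₂ _+_ (f≗g zero) (∑-cong (λ i → f≗g (suc i)))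

SameNeighbourhood : (G : Graph) → Fin (size G) → Fin (size G) → Set
SameNeighbourhood G v w = ∀ u → adj G v u ≡ adj G w u

weight-cong : ∀ G f {v w} → SameNeighbourhood G v w → weight G f v ≡ weight G f w
weight-cong G f same =
  ∑-cong (λ u → cong (λ b → if b then suc (toℕ (f u)) else 0) (same u))

twins⇒¬DAML : ∀ G {v w} → v ≢ w → SameNeighbourhood G v w → ¬ AdmitsDAML G
twins⇒¬DAML G v≢w same (f , injective) =
  v≢w (injective (weight-cong G (Bijection.to f) same))

join-sameNeighbourhood : ∀ G H {i j} → SameNeighbourhood H i j →
                         SameNeighbourhood (join G H) (size G ↑ʳ i) (size G ↑ʳ j)
join-sameNeighbourhood G H {i} {j} same u
  rewrite splitAt-↑ʳ (size G) (size H) i | splitAt-↑ʳ (size G) (size H) j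
  with splitAt (size G) u
... | inj₁ _ = refl
... | inj₂ y = same y

complementΓ₉-edgeless : ∀ x y → adj (complement (ZDGraph 9)) x y ≡ false
complementΓ₉-edgeless zero       zero       = refl
complementΓ₉-edgeless zero       (suc zero) = refl
complementΓ₉-edgeless (suc zero) zero       = refl
complementΓ₉-edgeless (suc zero) (suc zero) = refl

corollary2p7 : (m : ℕ) → m ≥ 1 → ¬ AdmitsDAML (join (copies m (ZDGraph 6)) (complement (ZDGraph 9)))
corollary2p7 m _ = twins⇒¬DAML (join G H) distinct twins
  where
    G = copies m (ZDGraph 6)
    H = complement (ZDGraph 9)

    distinct : size G ↑ʳ zero ≢ size G ↑ʳ suc zero
    distinct eq with ↑ʳ-injective (size G) zero (suc zero) eq
    ... | ()

    twins : SameNeighbourhood (join G H) (size G ↑ʳ zero) (size G ↑ʳ suc zero)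
    twins = join-sameNeighbourhood G H λ y →
      trans (complementΓ₉-edgeless zero y) (sym (complementΓ₉-edgeless (suc zero) y))
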